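{- Let $P$ be a disjunctive definite program and $M=\langle I,T\rangle$ an interpretation, and write $T3_P(M)=\langle I',T'\rangle$. Then $M$ is a model of $P$ if and only if $T'\cup I'\subseteq T\cup I$ (i.e. the false atoms of $T3_P(M)$ include the false atoms of $M$).
   Context: A disjunctive definite program $P$ consists of one clause per user-defined predicate $p$, of the form $p(V_1,\dots,V_n)\leftarrow (B_1\vee\dots\vee B_k)$, where $V_1,\dots,V_n$ are distinct variables and each disjunct $B_j$ is a conjunction consisting of equality atoms $V_1=T_1,\dots,V_n=T_n$ ($T_i$ terms) followed by user-defined atoms. Ground atoms are over the Herbrand universe of the program. An interpretation maps each ground user-defined atom to one of $\mathbf{T}$ (true), $\mathbf{F}$ (false), $\mathbf{I}$ (inadmissible); a ground equality atom $s=t$ is $\mathbf{T}$ if $s,t$ are syntactically identical and $\mathbf{F}$ otherwise. For disjoint sets $I,T$ of ground user-defined atoms, $\langle I,T\rangle$ maps atoms of $I$ to $\mathbf{I}$, atoms of $T$ to $\mathbf{T}$, all others to $\mathbf{F}$. Conjunction and disjunction use Kleene's strong three-valued logic: $\wedge$ is $\mathbf{F}$ if some argument is $\mathbf{F}$, else $\mathbf{I}$ if some argument is $\mathbf{I}$, else $\mathbf{T}$; $\vee$ is $\mathbf{T}$ if some argument is $\mathbf{T}$, else $\mathbf{I}$ if some argument is $\mathbf{I}$, else $\mathbf{F}$. An interpretation is a model of $P$ if there is no ground instance (all variables replaced by ground terms) $H\leftarrow B$ of a clause of $P$ with $H$ equal to $\mathbf{F}$ and $B$ equal to $\mathbf{T}$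 or $\mathbf{I}$. The operator $T3_P$ maps an interpretation $M$ to the interpretation in which a ground atom $A$ is: true if there is a ground clause instance $A\leftarrow B$ with $B$ true in $M$; false if for all ground clause instances $A\leftarrow B$, $B$ is false in $M$; inadmissible otherwise. -}

module Defs where

open import Data.Nat using (ℕ)
open import Data.Empty using (⊥)
open import Data.Fin using (Fin)
open import Data.List using (List; []; _∷_; map; _++_)
open import Data.Vec using (Vec; []; _∷_; lookup)
open import Data.Product using (Σ; _×_; _,_; proj₁; proj₂)
open import Data.Sum using (_⊎_)
open import Relation.Nullary using (¬_; Dec; yes; no)
open import Relation.Binary.PropositionalEquality using (_≡_; refl; cong)
open import Relation.Binary.Definitions using (DecidableEquality)

data TV : Set where
  𝐓 𝐅 𝐈 : TV

_∧₃_ : TV → TV → TV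
𝐅 ∧₃ _ = 𝐅
_ ∧₃ 𝐅 = 𝐅
𝐈 ∧₃ _ = 𝐈
_ ∧₃ 𝐈 = 𝐈
𝐓 ∧₃ 𝐓 = 𝐓

_∨₃_ : TV → TV → TV
𝐓 ∨₃ _ = 𝐓
_ ∨₃ 𝐓 = 𝐓
𝐈 ∨₃ _ = 𝐈
_ ∨₃ 𝐈 = 𝐈
𝐅 ∨₃ 𝐅 = 𝐅

⋀ : List TV → TV
⋀ []       = 𝐓
⋀ (v ∷ vs) = v ∧₃ ⋀ vs

⋁ : List TV → TV
⋁ []       = 𝐅
⋁ (v ∷ vs) = v ∨₃ ⋁ vs

-- Signature: function symbols (with arities, decidable equality so that
-- syntactic identity of ground terms can be evaluated) and predicates.

record Signature : Set₁ where
  field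
    Fun    : Set
    _≟F_   : DecidableEquality Fun
    fArity : Fun → ℕ
    Pred   : Set
    pArity : Pred → ℕ

module _ (S : Signature) where
  open Signature S

  data Term (X : Set) : Set where
    var : X → Term X
    fn  : (f : Fun) → Vec (Term X) (fArity f) → Term X

  PTerm : Set
  PTerm = Term ℕ

  GTerm : Set
  GTerm = Term ⊥

  GAtom : Set
  GAtom = Σ Pred (λ p → Vec GTerm (pArity p))

  Atom : Set
  Atom = Σ Pred (λ q → Vec PTerm (pArity q))

  GSubst : Set
  GSubst = ℕ → GTerm

  mutual
    applyT : GSubst → PTerm → GTerm
    applyT σ (var x)  = σ x
    applyT σ (fn f ts) = fn f (applyV σ ts)

    applyV : ∀ {n} → GSubst → Vec PTerm n → Vec GTerm n
    applyV σ []       = []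
    applyV σ (t ∷ ts) = applyT σ t ∷ applyV σ ts

  private
    fn-inj : ∀ {f} {ts us : Vec GTerm (fArity f)} → fn f ts ≡ fn f us → ts ≡ us
    fn-inj refl = refl

    fn-injˡ : ∀ {f g} {ts : Vec GTerm (fArity f)} {us : Vec GTerm (fArity g)} →
              fn f ts ≡ fn g us → f ≡ g
    fn-injˡ refl = refl

    ∷-injˡ : ∀ {n} {t u : GTerm} {ts us : Vec GTerm n} → t Vec.∷ ts ≡ u ∷ us → t ≡ u
    ∷-injˡ refl = refl

    ∷-injʳ : ∀ {n} {t u : GTerm} {ts us : Vec GTerm n} → t Vec.∷ ts ≡ u ∷ us → ts ≡ us
    ∷-injʳ refl = refl

  mutual
    _≟G_ : DecidableEquality GTerm
    var () ≟G _
    fn f ts ≟G var ()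
    fn f ts ≟G fn g us with f ≟F g
    ... | no f≢g = no (λ e → f≢g (fn-injˡ e))
    ... | yes refl with ≟Vs ts us
    ...   | yes refl = yes refl
    ...   | no ne = no (λ e → ne (fn-inj e))

    ≟Vs : ∀ {n} → DecidableEquality (Vec GTerm n)
    ≟Vs [] [] = yes refl
    ≟Vs (t ∷ ts) (u ∷ us) with t ≟G u | ≟Vs ts us
    ... | yes refl | yes refl = yes refl
    ... | no ne | _ = no (λ e → ne (∷-injˡ e))
    ... | yes _ | no ne = no (λ e → ne (∷-injʳ e))

  eqVal : GTerm → GTerm → TV
  eqVal s t with s ≟G t
  ... | yes _ = 𝐓
  ... | no _  = 𝐅

  -- one disjunct  V₁ = T₁ ∧ … ∧ Vₙ = Tₙ ∧ A₁ ∧ … ∧ Aₘ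
  record Disjunct (n : ℕ) : Set where
    field
      eqTerms : Vec PTerm n
      atoms   : List Atom

  record Clause (p : Pred) : Set where
    field
      headVars  : Vec ℕ (pArity p)
      distinct  : ∀ i j → lookup headVars i ≡ lookup headVars j → i ≡ j
      disjuncts : List (Disjunct (pArity p))

  Program : Set
  Program = (p : Pred) → Clause p

  -- interpretations (an interpretation ⟨I,T⟩ is M with I = M⁻¹(𝐈), T = M⁻¹(𝐓))
  Interp : Set
  Interp = GAtom → TV

  module _ (P : Program) (M : Interp) where

    private
      eqVals : ∀ {n} → GSubst → Vec ℕ n → Vec PTerm n → List TV
      eqVals σ [] [] = []
      eqVals σ (v ∷ vs) (t ∷ ts) = eqVal (σ v) (applyT σ t) ∷ eqVals σ vs ts

      atomVal : GSubst → Atom → TV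
      atomVal σ (q , ts) = M (q , applyV σ ts)

    instHead : (p : Pred) → GSubst → GAtom
    instHead p σ = p , applyV σ (map′ (Clause.headVars (P p)))
      where
        map′ : ∀ {n} → Vec ℕ n → Vec PTerm n
        map′ [] = []
        map′ (x ∷ xs) = var x ∷ map′ xs

    instBody : (p : Pred) → GSubst → TV
    instBody p σ = ⋁ (map disjVal (Clause.disjuncts (P p)))
      where
        disjVal : Disjunct (pArity p) → TV
        disjVal d = ⋀ (eqVals σ (Clause.headVars (P p)) (Disjunct.eqTerms d)
                       ++ map (atomVal σ) (Disjunct.atoms d))

    IsModel : Set
    IsModel = ∀ (p : Pred) (σ : GSubst) →
              ¬ (M (instHead p σ) ≡ 𝐅 × (instBody p σ ≡ 𝐓 ⊎ instBody p σ ≡ 𝐈))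

    -- "T3_P(M) assigns value v to ground atom A"
    T3 : GAtom → TV → Set
    T3 A 𝐓 = Σ GSubst (λ σ → instHead (proj₁ A) σ ≡ A × instBody (proj₁ A) σ ≡ 𝐓)
    T3 A 𝐅 = ∀ (σ : GSubst) → instHead (proj₁ A) σ ≡ A → instBody (proj₁ A) σ ≡ 𝐅
    T3 A 𝐈 = ¬ T3 A 𝐓 × ¬ T3 A 𝐅

{-# OPTIONS --safe #-}
module Submission where

open import Defs
open import Data.Sum using (_⊎_; inj₁; inj₂)
open import Data.Product using (_,_; proj₁)
open import Data.Empty using (⊥-elim)
open import Relation.Nullary using (¬_)
open import Relation.Binary.PropositionalEquality using (_≡_; _≢_; refl; sym; subst)
open import Function.Bundles using (_⇔_; mk⇔)

-- M is a model iff every atom false in M has only false ground-instance bodies, i.e. is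
-- false under T3; and being false under T3 excludes being true or inadmissible under it.
-- Conversely, an instance with a non-false body makes its head true or inadmissible under
-- T3, though only up to double negation, since inadmissibility under T3 is defined
-- negatively; that is enough because the model property is itself a negation.

NonFalse : TV → Set
NonFalse v = v ≡ 𝐓 ⊎ v ≡ 𝐈

nonFalse⇒≢𝐅 : ∀ {v} → NonFalse v → v ≢ 𝐅
nonFalse⇒≢𝐅 (inj₁ refl) ()
nonFalse⇒≢𝐅 (inj₂ refl) ()

≢𝐅⇒nonFalse : ∀ {v} → v ≢ 𝐅 → NonFalse v
≢𝐅⇒nonFalse {𝐓} _   = inj₁ refl
≢𝐅⇒nonFalse {𝐅} v≢𝐅 = ⊥-elim (v≢𝐅 refl)
≢𝐅⇒nonFalse {𝐈} _   = inj₂ refl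

¬nonFalse⇒≡𝐅 : ∀ {v} → ¬ NonFalse v → v ≡ 𝐅
¬nonFalse⇒≡𝐅 {𝐓} ¬nf = ⊥-elim (¬nf (inj₁ refl))
¬nonFalse⇒≡𝐅 {𝐅} _   = refl
¬nonFalse⇒≡𝐅 {𝐈} ¬nf = ⊥-elim (¬nf (inj₂ refl))

module _ (S : Signature) (P : Program S) (M : Interp S) where

  T3-𝐅⇒¬T3-𝐓⊎𝐈 : ∀ {A} → T3 S P M A 𝐅 → ¬ (T3 S P M A 𝐓 ⊎ T3 S P M A 𝐈)
  T3-𝐅⇒¬T3-𝐓⊎𝐈 allFalse (inj₁ (σ , head≡A , body≡𝐓)) =
    nonFalse⇒≢𝐅 (inj₁ body≡𝐓) (allFalse σ head≡A)
  T3-𝐅⇒¬T3-𝐓⊎𝐈 allFalse (inj₂ (_ , ¬allFalse)) = ¬allFalse allFalse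

  nonFalseBody⇒¬¬T3-𝐓⊎𝐈 : ∀ {p σ} → instBody S P M p σ ≢ 𝐅 →
    let A = instHead S P M p σ in ¬ ¬ (T3 S P M A 𝐓 ⊎ T3 S P M A 𝐈)
  nonFalseBody⇒¬¬T3-𝐓⊎𝐈 {σ = σ} body≢𝐅 ¬T3-𝐓⊎𝐈 =
    ¬T3-𝐓⊎𝐈 (inj₂ ((λ t → ¬T3-𝐓⊎𝐈 (inj₁ t)) , (λ allFalse → body≢𝐅 (allFalse σ refl))))

  model⇒falseAtom⇒T3-𝐅 : IsModel S P M → ∀ {A} → M A ≡ 𝐅 → T3 S P M A 𝐅
  model⇒falseAtom⇒T3-𝐅 model {A} MA≡𝐅 σ head≡A =
    ¬nonFalse⇒≡𝐅 λ body-nf →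
      model (proj₁ A) σ (subst (λ B → M B ≡ 𝐅) (sym head≡A) MA≡𝐅 , body-nf)

mainTheorem6 : (S : Signature) (P : Program S) (M : Interp S) →
               IsModel S P M ⇔
                 (∀ (A : GAtom S) → (T3 S P M A 𝐓 ⊎ T3 S P M A 𝐈) → (M A ≡ 𝐓 ⊎ M A ≡ 𝐈))
mainTheorem6 S P M = mk⇔ model⇒T3-𝐓⊎𝐈⇒nonFalse T3-𝐓⊎𝐈⇒nonFalse⇒model
  where
  model⇒T3-𝐓⊎𝐈⇒nonFalse : IsModel S P M →
    ∀ A → T3 S P M A 𝐓 ⊎ T3 S P M A 𝐈 → NonFalse (M A)
  model⇒T3-𝐓⊎𝐈⇒nonFalse model A t3 =
    ≢𝐅⇒nonFalse (λ MA≡𝐅 → T3-𝐅⇒¬T3-𝐓⊎𝐈 S P M (model⇒falseAtom⇒T3-𝐅 S P M model MA≡𝐅) t3)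

  T3-𝐓⊎𝐈⇒nonFalse⇒model : (∀ A → T3 S P M A 𝐓 ⊎ T3 S P M A 𝐈 → NonFalse (M A)) → IsModel S P M
  T3-𝐓⊎𝐈⇒nonFalse⇒model H p σ (head≡𝐅 , body-nf) =
    nonFalseBody⇒¬¬T3-𝐓⊎𝐈 S P M (nonFalse⇒≢𝐅 body-nf)
      (λ t3 → nonFalse⇒≢𝐅 (H (instHead S P M p σ) t3) head≡𝐅)
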